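{- If $G_1,G_2$ are $\mathbb{Z}$-valued well-tempered games with $G_1$ odd-tempered and $G_2$ even-tempered, then $G_1$ and $G_2$ are incomparable with respect to $\lesssim$ (neither $G_1\lesssim G_2$ nor $G_2\lesssim G_1$). In particular, no two games of differing parity are equivalent under $\approx$.
   Context: Well-tempered $\mathbb{Z}$-valued games: an even-tempered game is an integer (a "number", with no options) or $\langle L\mid R\rangle$ with $L,R$ finite nonempty sets of odd-tempered games; an odd-tempered game is $\langle L\mid R\rangle$ with $L,R$ finite nonempty sets of even-tempered games; $\mathcal{W}_\mathbb{Z}$ is the set of all of them. Outcomes: $L(n)=R(n)=n$ for numbers; otherwise $L(G)=\max_{G^L}R(G^L)$, $R(G)=\min_{G^R}L(G^R)$. Sum: integer sum if both numbers, otherwise $G+H=\langle G^L+H, G+H^L\mid G^R+H, G+H^R\rangle$. Define $G\lesssim H$ iff $L(G+X)\le L(H+X)$ and $R(G+X)\le R(H+X)$ for all $X\in\mathcal{W}_\mathbb{Z}$, and $G\approx H$ iff $G\lesssim H$ and $H\lesssim G$. -}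

module Defs where

open import Data.Integer using (ℤ; _≤_; _⊔_; _⊓_) renaming (_+_ to _+ℤ_)
open import Data.List using (List; []; _∷_; _++_)
open import Data.List.Relation.Unary.All using (All)
open import Data.Product using (Σ; ∃; _,_; _×_)
open import Relation.Nullary using (¬_)

-- Nonemptiness is built in by taking the head option separately.
data Game : Set where
  num  : ℤ → Game
  node : Game → List Game → Game → List Game → Game

mutual
  data Even : Game → Set where
    even-num  : ∀ n → Even (num n)
    even-node : ∀ {l ls r rs} → Odd l → All Odd ls → Odd r → All Odd rs →
                Even (node l ls r rs)

  data Odd : Game → Set where
    odd-node : ∀ {l ls r rs} → Even l → All Even ls → Even r → All Even rs →
               Odd (node l ls r rs)

data WellTempered (G : Game) : Set where
  wt-even : Even G → WellTempered G
  wt-odd  : Odd G → WellTempered G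

mutual
  Lo : Game → ℤ
  Lo (num n)           = n
  Lo (node l ls _ _)   = maxR l ls

  Ro : Game → ℤ
  Ro (num n)           = n
  Ro (node _ _ r rs)   = minL r rs

  maxR : Game → List Game → ℤ
  maxR g []       = Ro g
  maxR g (h ∷ hs) = Ro g ⊔ maxR h hs

  minL : Game → List Game → ℤ
  minL g []       = Lo g
  minL g (h ∷ hs) = Lo g ⊓ minL h hs

mutual
  _+G_ : Game → Game → Game
  num m +G num n = num (m +ℤ n)
  num m +G node hl hls hr hrs =
    node (num m +G hl) (addL (num m) hls) (num m +G hr) (addL (num m) hrs)
  node gl gls gr grs +G num n =
    node (gl +G num n) (addR gls (num n)) (gr +G num n) (addR grs (num n))
  node gl gls gr grs +G node hl hls hr hrs =
    node (gl +G node hl hls hr hrs)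
         (addR gls (node hl hls hr hrs) ++
            (node gl gls gr grs +G hl) ∷ addL (node gl gls gr grs) hls)
         (gr +G node hl hls hr hrs)
         (addR grs (node hl hls hr hrs) ++
            (node gl gls gr grs +G hr) ∷ addL (node gl gls gr grs) hrs)

  addR : List Game → Game → List Game
  addR []       h = []
  addR (x ∷ xs) h = (x +G h) ∷ addR xs h

  addL : Game → List Game → List Game
  addL g []       = []
  addL g (y ∷ ys) = (g +G y) ∷ addL g ys

_≲_ : Game → Game → Set
G ≲ H = ∀ X → WellTempered X → Lo (G +G X) ≤ Lo (H +G X) × Ro (G +G X) ≤ Ro (H +G X)

_≈G_ : Game → Game → Set
G ≈G H = G ≲ H × H ≲ G

module Submission where

-- The test game is the zugzwang  Z N = ⟨ ⟨-N ∣ -N⟩ ∣ ⟨N ∣ N⟩ ⟩ : it is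
-- even-tempered, and whoever moves in it first gives away N points.  In
-- G + Z N the player who runs out of useful moves in G is forced into Z N.
-- Tempering decides who that is: playing G to its end takes an odd number
-- of moves when G is odd and an even number when G is even, so for odd G
-- Left comes out ahead by N, and for even G Right does
-- (separation lemmas evenLo-below / oddLo-above and their mirror images).
--
-- To turn "ahead by N" into numbers we bound outcomes by leaves: a property
-- P of integers that holds at every leaf of K and is closed under ⊔ and ⊓
-- holds of L(K) and R(K) (Lo-Leaves, Ro-Leaves), and leaf bounds add up along
-- sums (Leaves-+).  Choosing N larger than every leaf of G₁ and G₂ in
-- absolute value, either comparison G₁ ≲ G₂ or G₂ ≲ G₁, tested against Z N,
-- yields  -B + N ≤ B - N  for B the leaf bound and N = B + 1, which is false.

open import Defs
open import Data.Integer using (ℤ; _≤_; _<_; _⊔_; _⊓_; -_; _-_; 0ℤ; 1ℤ; -1ℤ; -<+)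
  renaming (_+_ to _+ℤ_)
open import Data.Integer.Properties
open import Data.Integer.Solver using (module +-*-Solver)
open import Data.List using (List; []; _∷_; _++_)
open import Data.List.Relation.Unary.All using (All; []; _∷_)
open import Data.List.Relation.Unary.All.Properties using (++⁺)
open import Data.Product using (_×_; _,_; proj₁; proj₂)
open import Relation.Binary.PropositionalEquality using (_≡_; refl; subst; subst₂)
open import Relation.Nullary using (¬_)

data Leaves (P : ℤ → Set) : Game → Set where
  leaf : ∀ {n} → P n → Leaves P (num n)
  node : ∀ {l ls r rs} → Leaves P l → All (Leaves P) ls →
         Leaves P r → All (Leaves P) rs → Leaves P (node l ls r rs)

module _ {P Q : ℤ → Set} (weaken : ∀ {n} → P n → Q n) where
  mutual
    Leaves-map : ∀ {G} → Leaves P G → Leaves Q G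
    Leaves-map (leaf p)       = leaf (weaken p)
    Leaves-map (node l ls r rs) =
      node (Leaves-map l) (Leaves-mapAll ls) (Leaves-map r) (Leaves-mapAll rs)

    Leaves-mapAll : ∀ {Gs} → All (Leaves P) Gs → All (Leaves Q) Gs
    Leaves-mapAll []       = []
    Leaves-mapAll (g ∷ gs) = Leaves-map g ∷ Leaves-mapAll gs

module _ {P Q R : ℤ → Set} (combine : ∀ {m n} → P m → Q n → R (m +ℤ n)) where
  mutual
    Leaves-+ : ∀ {G H} → Leaves P G → Leaves Q H → Leaves R (G +G H)
    Leaves-+ (leaf p) (leaf q) = leaf (combine p q)
    Leaves-+ g@(leaf _) (node hl hls hr hrs) =
      node (Leaves-+ g hl) (Leaves-+L g hls) (Leaves-+ g hr) (Leaves-+L g hrs)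
    Leaves-+ (node gl gls gr grs) h@(leaf _) =
      node (Leaves-+ gl h) (Leaves-+R gls h) (Leaves-+ gr h) (Leaves-+R grs h)
    Leaves-+ g@(node gl gls gr grs) h@(node hl hls hr hrs) =
      node (Leaves-+ gl h) (++⁺ (Leaves-+R gls h) (Leaves-+ g hl ∷ Leaves-+L g hls))
           (Leaves-+ gr h) (++⁺ (Leaves-+R grs h) (Leaves-+ g hr ∷ Leaves-+L g hrs))

    Leaves-+R : ∀ {Gs H} → All (Leaves P) Gs → Leaves Q H → All (Leaves R) (addR Gs H)
    Leaves-+R []       h = []
    Leaves-+R (g ∷ gs) h = Leaves-+ g h ∷ Leaves-+R gs h

    Leaves-+L : ∀ {G Hs} → Leaves P G → All (Leaves Q) Hs → All (Leaves R) (addL G Hs)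
    Leaves-+L g []       = []
    Leaves-+L g (h ∷ hs) = Leaves-+ g h ∷ Leaves-+L g hs

maxR-ge : ∀ g gs → Ro g ≤ maxR g gs
maxR-ge g []       = ≤-refl
maxR-ge g (h ∷ hs) = i≤i⊔j (Ro g) (maxR h hs)

minL-le : ∀ g gs → minL g gs ≤ Lo g
minL-le g []       = ≤-refl
minL-le g (h ∷ hs) = i⊓j≤i (Lo g) (minL h hs)

module _ (P : ℤ → Set) where
  maxR-closed : (∀ {m n} → P m → P n → P (m ⊔ n)) →
                ∀ {g gs} → P (Ro g) → All (λ x → P (Ro x)) gs → P (maxR g gs)
  maxR-closed ⊔-closed p []       = p
  maxR-closed ⊔-closed p (q ∷ qs) = ⊔-closed p (maxR-closed ⊔-closed q qs)

  minL-closed : (∀ {m n} → P m → P n → P (m ⊓ n)) →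
                ∀ {g gs} → P (Lo g) → All (λ x → P (Lo x)) gs → P (minL g gs)
  minL-closed ⊓-closed p []       = p
  minL-closed ⊓-closed p (q ∷ qs) = ⊓-closed p (minL-closed ⊓-closed q qs)

-- Outcomes are lattice combinations of leaves, so any leaf property closed
-- under ⊔ and ⊓ passes to both outcomes.
module _ {P : ℤ → Set}
         (⊔-closed : ∀ {m n} → P m → P n → P (m ⊔ n))
         (⊓-closed : ∀ {m n} → P m → P n → P (m ⊓ n)) where
  mutual
    Lo-Leaves : ∀ {K} → Leaves P K → P (Lo K)
    Lo-Leaves (leaf p)        = p
    Lo-Leaves (node l ls _ _) = maxR-closed P ⊔-closed (Ro-Leaves l) (Ro-LeavesAll ls)

    Ro-Leaves : ∀ {K} → Leaves P K → P (Ro K)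
    Ro-Leaves (leaf p)        = p
    Ro-Leaves (node _ _ r rs) = minL-closed P ⊓-closed (Lo-Leaves r) (Lo-LeavesAll rs)

    Lo-LeavesAll : ∀ {Ks} → All (Leaves P) Ks → All (λ x → P (Lo x)) Ks
    Lo-LeavesAll []       = []
    Lo-LeavesAll (k ∷ ks) = Lo-Leaves k ∷ Lo-LeavesAll ks

    Ro-LeavesAll : ∀ {Ks} → All (Leaves P) Ks → All (λ x → P (Ro x)) Ks
    Ro-LeavesAll []       = []
    Ro-LeavesAll (k ∷ ks) = Ro-Leaves k ∷ Ro-LeavesAll ks

BoundedAbove : ℤ → Game → Set
BoundedAbove b = Leaves (_≤ b)

BoundedBelow : ℤ → Game → Set
BoundedBelow a = Leaves (a ≤_)

Ro-above : ∀ {b K} → BoundedAbove b K → Ro K ≤ b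
Ro-above {b} = Ro-Leaves {P = _≤ b} ⊔-lub (λ {m} {n} p _ → ≤-trans (i⊓j≤i m n) p)

Lo-below : ∀ {a K} → BoundedBelow a K → a ≤ Lo K
Lo-below {a} = Lo-Leaves {P = a ≤_} (λ {m} {n} p _ → ≤-trans p (i≤i⊔j m n)) ⊓-glb

mutual
  leafBound : Game → ℤ
  leafBound (num n)          = n ⊔ - n
  leafBound (node l ls r rs) = (leafBound l ⊔ leafBoundAll ls) ⊔ (leafBound r ⊔ leafBoundAll rs)

  leafBoundAll : List Game → ℤ
  leafBoundAll []       = 0ℤ
  leafBoundAll (g ∷ gs) = leafBound g ⊔ leafBoundAll gs

mutual
  leafBound-sound : ∀ G {B} → leafBound G ≤ B → Leaves (λ n → n ⊔ - n ≤ B) G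
  leafBound-sound (num n) p = leaf p
  leafBound-sound (node l ls r rs) p =
    node (leafBound-sound l (i⊔j≤k⇒i≤k _ _ left)) (leafBoundAll-sound ls (i⊔j≤k⇒j≤k _ _ left))
         (leafBound-sound r (i⊔j≤k⇒i≤k _ _ right)) (leafBoundAll-sound rs (i⊔j≤k⇒j≤k _ _ right))
    where
      left  = i⊔j≤k⇒i≤k _ _ p
      right = i⊔j≤k⇒j≤k _ _ p

  leafBoundAll-sound : ∀ Gs {B} → leafBoundAll Gs ≤ B → All (Leaves (λ n → n ⊔ - n ≤ B)) Gs
  leafBoundAll-sound []       p = []
  leafBoundAll-sound (g ∷ gs) p =
    leafBound-sound g (i⊔j≤k⇒i≤k _ _ p) ∷ leafBoundAll-sound gs (i⊔j≤k⇒j≤k _ _ p)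

leafBound-above : ∀ G {B} → leafBound G ≤ B → BoundedAbove B G
leafBound-above G p = Leaves-map (i⊔j≤k⇒i≤k _ _) (leafBound-sound G p)

leafBound-below : ∀ G {B} → leafBound G ≤ B → BoundedBelow (- B) G
leafBound-below G p = Leaves-map below (leafBound-sound G p)
  where
    below : ∀ {n B} → n ⊔ - n ≤ B → - B ≤ n
    below {n} q = subst (_ ≤_) (neg-involutive n) (neg-mono-≤ (i⊔j≤k⇒j≤k _ _ q))

module _ (N : ℤ) where
  forced : ℤ → Game
  forced n = node (num n) [] (num n) []

  zugzwang : Game
  zugzwang = node (forced (- N)) [] (forced N) []

  zugzwang-even : Even zugzwang
  zugzwang-even = even-node forced-odd [] forced-odd []
    where
      forced-odd : ∀ {n} → Odd (forced n)
      forced-odd = odd-node (even-num _) [] (even-num _) []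

  shift-left : ∀ {b G} → BoundedAbove b G → Ro (G +G forced (- N)) ≤ b - N
  shift-left g = Ro-above (Leaves-+ +-mono-≤ g (node (leaf ≤-refl) [] (leaf ≤-refl) []))

  shift-right : ∀ {a G} → BoundedBelow a G → a +ℤ N ≤ Lo (G +G forced N)
  shift-right g = Lo-below (Leaves-+ +-mono-≤ g (node (leaf ≤-refl) [] (leaf ≤-refl) []))

  -- In G + Z N, Left moving first gets N beyond G's leaves when G is odd,
  -- and Right does when G is even: in the even cases the player to move
  -- eventually has to open the zugzwang.
  mutual
    oddLo-above : ∀ {a G} → Odd G → BoundedBelow a G → a +ℤ N ≤ Lo (G +G zugzwang)
    oddLo-above {G = G@(node gl gls _ _)} (odd-node el _ _ _) (node l _ _ _) =
      ≤-trans (evenRo-above el l) (maxR-ge _ (addR gls zugzwang ++ G +G forced (- N) ∷ []))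

    oddRo-below : ∀ {b G} → Odd G → BoundedAbove b G → Ro (G +G zugzwang) ≤ b - N
    oddRo-below {G = G@(node _ _ gr grs)} (odd-node _ _ er _) (node _ _ r _) =
      ≤-trans (minL-le _ (addR grs zugzwang ++ G +G forced N ∷ [])) (evenLo-below er r)

    evenLo-below : ∀ {b G} → Even G → BoundedAbove b G → Lo (G +G zugzwang) ≤ b - N
    evenLo-below (even-num n) g = shift-left g
    evenLo-below {b} (even-node ol ols _ _) g@(node l ls _ _) =
      maxR-closed (_≤ b - N) ⊔-lub (oddRo-below ol l) (++⁺ (oddRo-belowAll ols ls) (shift-left g ∷ []))

    evenRo-above : ∀ {a G} → Even G → BoundedBelow a G → a +ℤ N ≤ Ro (G +G zugzwang)
    evenRo-above (even-num n) g = shift-right g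
    evenRo-above {a} (even-node _ _ or ors) g@(node _ _ r rs) =
      minL-closed (a +ℤ N ≤_) ⊓-glb (oddLo-above or r) (++⁺ (oddLo-aboveAll ors rs) (shift-right g ∷ []))

    oddRo-belowAll : ∀ {b Gs} → All Odd Gs → All (BoundedAbove b) Gs →
                     All (λ x → Ro x ≤ b - N) (addR Gs zugzwang)
    oddRo-belowAll []       []       = []
    oddRo-belowAll (o ∷ os) (g ∷ gs) = oddRo-below o g ∷ oddRo-belowAll os gs

    oddLo-aboveAll : ∀ {a Gs} → All Odd Gs → All (BoundedBelow a) Gs →
                     All (λ x → a +ℤ N ≤ Lo x) (addR Gs zugzwang)
    oddLo-aboveAll []       []       = []
    oddLo-aboveAll (o ∷ os) (g ∷ gs) = oddLo-above o g ∷ oddLo-aboveAll os gs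

bounds-cross : ∀ B → ¬ (- B +ℤ (B +ℤ 1ℤ) ≤ B - (B +ℤ 1ℤ))
bounds-cross B = <⇒≱ (subst₂ _<_ right-side left-side -<+)
  where
    open +-*-Solver
    right-side : -1ℤ ≡ B - (B +ℤ 1ℤ)
    right-side = solve 1 (λ B → con -1ℤ := B :- (B :+ con 1ℤ)) refl B
    left-side : 1ℤ ≡ - B +ℤ (B +ℤ 1ℤ)
    left-side = solve 1 (λ B → con 1ℤ := :- B :+ (B :+ con 1ℤ)) refl B

mainTheorem7 : ∀ (G₁ G₂ : Game) → Odd G₁ → Even G₂ →
    (¬ (G₁ ≲ G₂) × ¬ (G₂ ≲ G₁)) × ¬ (G₁ ≈G G₂)
mainTheorem7 G₁ G₂ o₁ e₂ = (not-below , not-above) , λ equiv → not-below (proj₁ equiv)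
  where
    B = leafBound G₁ ⊔ leafBound G₂
    N = B +ℤ 1ℤ
    b₁ = i≤i⊔j (leafBound G₁) (leafBound G₂)
    b₂ = i≤j⊔i (leafBound G₁) (leafBound G₂)

    not-below : ¬ (G₁ ≲ G₂)
    not-below G₁≲G₂ = bounds-cross B
      (≤-trans (oddLo-above N o₁ (leafBound-below G₁ b₁))
      (≤-trans (proj₁ (G₁≲G₂ (zugzwang N) (wt-even (zugzwang-even N))))
               (evenLo-below N e₂ (leafBound-above G₂ b₂))))

    not-above : ¬ (G₂ ≲ G₁)
    not-above G₂≲G₁ = bounds-cross B
      (≤-trans (evenRo-above N e₂ (leafBound-below G₂ b₂))
      (≤-trans (proj₂ (G₂≲G₁ (zugzwang N) (wt-even (zugzwang-even N))))
               (oddRo-below N o₁ (leafBound-above G₁ b₁))))
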